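{- Let $\mathcal{D}$ be the set of all partitions into distinct parts (including the empty partition) and let $\ell(\lambda)$ denote the number of parts of $\lambda$. Then, as formal power series in $q$ and $z$, $$\sum_{\substack{\lambda\in\mathcal{D}\\ \ell(\lambda)\equiv 0\text{ or }3 \pmod 4}} z^{\lambda_1}q^{\lambda_1+\lambda_5+\lambda_9+\cdots}=1+\sum_{n=1}^\infty\frac{q^{\binom{2n+1}{2}}z^{4n-1}}{(qz;q)_n^4}$$ and $$\sum_{\substack{\lambda\in\mathcal{D}\\ \ell(\lambda)\equiv 1\text{ or }2 \pmod 4}} z^{\lambda_1}q^{\lambda_1+\lambda_5+\lambda_9+\cdots}=\sum_{n=1}^\infty\frac{q^{\binom{2n}{2}}z^{4n-3}}{(qz;q)_n^2\,(qz;q)_{n-1}^2}.$$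
   Context: A partition is a weakly decreasing sequence of nonnegative integers $\lambda=(\lambda_1,\lambda_2,\dots)$, eventually zero; $\lambda_i=0$ beyond the last part; it has distinct parts if no nonzero value is repeated. The $q$-Pochhammer symbol is $(a;q)_n=\prod_{k=0}^{n-1}(1-aq^k)$ for integers $n\ge0$. -}

module Defs where

open import Data.Nat as ℕ using (ℕ; zero; suc; _∸_; _%_; _≡ᵇ_)
open import Data.Nat.Combinatorics using (_C_)
open import Data.Integer using (ℤ; +_; _+_; _*_; _-_)
open import Data.List using (List; []; _∷_; _++_; map; length; drop)
open import Data.Bool using (Bool; true; false; _∧_; _∨_; if_then_else_)

-- Bivariate formal power series in q and z with integer coefficients.
-- A series F is given by its coefficients: F a b = [q^a z^b] F.

PS : Set
PS = ℕ → ℕ → ℤ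

sumTo : ℕ → (ℕ → ℤ) → ℤ
sumTo zero    f = f 0
sumTo (suc n) f = sumTo n f + f (suc n)

sumSeries1 : ℕ → (ℕ → PS) → PS
sumSeries1 zero    F a b = + 0
sumSeries1 (suc n) F a b = sumSeries1 n F a b + F (suc n) a b

mono : ℕ → ℕ → PS
mono a b i j = if (i ≡ᵇ a) ∧ (j ≡ᵇ b) then + 1 else + 0

one : PS
one = mono 0 0

_⊕_ : PS → PS → PS
(F ⊕ G) a b = F a b + G a b

_⊖_ : PS → PS → PS
(F ⊖ G) a b = F a b - G a b

_⊛_ : PS → PS → PS
(F ⊛ G) a b = sumTo a λ i → sumTo b λ j → F i j * G (a ∸ i) (b ∸ j)

infixl 7 _⊛_
infixl 6 _⊕_ _⊖_

pow : PS → ℕ → PS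
pow F zero    = one
pow F (suc k) = F ⊛ pow F k

-- Multiplicative inverse of a series F with constant term 1:
-- F⁻¹ = Σ_{k ≥ 0} (1 - F)^k ; since 1 - F has no constant term,
-- (1 - F)^k only has terms of total degree ≥ k, so the coefficient of
-- q^a z^b only receives contributions from k ≤ a + b.
inv : PS → PS
inv F a b = sumTo (a ℕ.+ b) λ k → pow (one ⊖ F) k a b

-- (qz;q)_n = ∏_{k=0}^{n-1} (1 - qz q^k)
poch : ℕ → PS
poch zero    = one
poch (suc n) = poch n ⊛ (one ⊖ mono (suc n) 1)

-- Partitions into distinct parts, as strictly decreasing lists of
-- positive integers (λ₁ > λ₂ > … > λ_ℓ > 0).
-- dparts m lists every partition into distinct parts all ≤ m, each once.

dparts : ℕ → List (List ℕ)
dparts zero    = [] ∷ []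
dparts (suc m) = dparts m ++ map (suc m ∷_) (dparts m)

largest : List ℕ → ℕ
largest []      = 0
largest (x ∷ _) = x

every4th : List ℕ → ℕ
every4th []                     = 0
every4th (x ∷ [])                = x
every4th (x ∷ _ ∷ [])            = x
every4th (x ∷ _ ∷ _ ∷ [])        = x
every4th (x ∷ _ ∷ _ ∷ _ ∷ xs)    = x ℕ.+ every4th xs

count : {A : Set} → (A → Bool) → List A → ℕ
count p []       = 0
count p (x ∷ xs) = (if p x then 1 else 0) ℕ.+ count p xs

len03 : List ℕ → Bool
len03 λ′ = (length λ′ % 4 ≡ᵇ 0) ∨ (length λ′ % 4 ≡ᵇ 3)

len12 : List ℕ → Bool
len12 λ′ = (length λ′ % 4 ≡ᵇ 1) ∨ (length λ′ % 4 ≡ᵇ 2)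

-- Σ_{λ ∈ D, cond λ} z^{λ₁} q^{λ₁+λ₅+λ₉+⋯}: coefficient of q^a z^b is
-- the number of λ ∈ D with cond λ, λ₁ = b, λ₁+λ₅+⋯ = a.
-- Every such λ has all parts ≤ b, hence occurs (once) in dparts b.
genD : (List ℕ → Bool) → PS
genD cond a b =
  + count (λ λ′ → cond λ′ ∧ (largest λ′ ≡ᵇ b) ∧ (every4th λ′ ≡ᵇ a)) (dparts b)

LHS₁ LHS₂ : PS
LHS₁ = genD len03
LHS₂ = genD len12

term₁ : ℕ → PS
term₁ n = mono ((2 ℕ.* n ℕ.+ 1) C 2) (4 ℕ.* n ∸ 1) ⊛ inv (pow (poch n) 4)

term₂ : ℕ → PS
term₂ n = mono ((2 ℕ.* n) C 2) (4 ℕ.* n ∸ 3)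
          ⊛ inv (pow (poch n) 2 ⊛ pow (poch (n ∸ 1)) 2)

RHS₁ : ℕ → PS
RHS₁ N = one ⊕ sumSeries1 N term₁

RHS₂ : ℕ → PS
RHS₂ N = sumSeries1 N term₂

-- A series F equals the (formal-topology) limit of the partial sums S N:
-- every coefficient of S N is eventually equal to that of F.
open import Relation.Binary.PropositionalEquality using (_≡_)
open import Data.Product using (∃)

ConvergesTo : (ℕ → PS) → PS → Set
ConvergesTo S F = ∀ a b → ∃ λ N₀ → ∀ N → N₀ ℕ.≤ N → S N a b ≡ F a b

{-# OPTIONS --safe #-}
-- Let D m be the generating function of the partitions into distinct parts with exactly m parts.
-- Deleting the part 1 of such a partition with m + 1 parts (if present) and lowering the other
-- parts by one lowers λ₁ by 1 and λ₁ + λ₅ + ⋯ by ⌈(m+1)/4⌉ and leaves m + 1 or m parts, whence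
-- D (m+1) = q^⌈(m+1)/4⌉ z (D (m+1) + D m). With E m = ∏_{j ≤ m} (1 - q^⌈j/4⌉ z) this gives
-- D m E m = q^{Σ_{j ≤ m} ⌈j/4⌉} z^m, hence (D (m+1) + D m) E (m+1) = q^{Σ_{j ≤ m} ⌈j/4⌉} z^m.
-- For m = 4n-1 and m = 4n-3, E (m+1) is (qz;q)_n^4 resp. (qz;q)_n^2 (qz;q)_{n-1}^2 and the exponent
-- of q is C(2n+1,2) resp. C(2n,2), so the n-th summands on the right are D 4n + D (4n-1) and
-- D (4n-2) + D (4n-3). Only partitions with at most b parts contribute to z^b, so the partial sums
-- agree with the left-hand sides coefficientwise once 4N ≥ b.
module Submission where

open import Defs
open import Algebra.Bundles using (CommutativeRing)
import Algebra.Properties.CommutativeSemigroup as CommSemigroupProperties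
import Algebra.Solver.CommutativeMonoid as CommMonoidSolver
open import Data.Bool using (Bool; true; false; _∧_; _∨_; if_then_else_)
import Data.Bool.Properties as BoolP
open import Data.Fin as Fin using (Fin)
open import Data.Fin.Patterns using (0F; 1F; 2F; 3F)
open import Data.Integer as ℤ using (ℤ; +_)
import Data.Integer.Properties as ℤP
import Data.Integer.Tactic.RingSolver as ℤ-Solver
open import Data.List using (List; []; _∷_; _++_; map; length)
import Data.List.Properties as ListP
open import Data.List.Relation.Unary.All as All using (All; []; _∷_)
import Data.List.Relation.Unary.All.Properties as AllP
open import Data.Nat as ℕ using (ℕ; zero; suc; _∸_; _≤_; _<_; z≤n; s≤s; _≡ᵇ_; _%_)
open import Data.Nat.Combinatorics using (_C_; nC1≡n; nCk+nC[k+1]≡[n+1]C[k+1])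
open import Data.Nat.DivMod using ([m+kn]%n≡m%n)
import Data.Nat.Properties as ℕP
import Data.Nat.Tactic.RingSolver as ℕ-Solver
open import Data.Product using (_×_; _,_)
open import Data.Sum using (_⊎_; inj₁; inj₂)
open import Data.Vec using ([]; _∷_)
open import Function using (_∘_)
import Relation.Binary.PropositionalEquality as ≡
open import Relation.Nullary using (yes; no)
open import Relation.Nullary.Decidable using (dec-true; dec-false)

module Convolution {c ℓ} (R : CommutativeRing c ℓ) where
  open CommutativeRing R
  open ≡ using (_≢_)
  open CommSemigroupProperties +-commutativeSemigroup using (interchange)
  open import Relation.Binary.Reasoning.Setoid setoid

  ∑ : ℕ → (ℕ → Carrier) → Carrier
  ∑ zero    f = f 0
  ∑ (suc n) f = ∑ n f + f (suc n)

  ∑-cong : ∀ n {f g : ℕ → Carrier} → (∀ i → i ≤ n → f i ≈ g i) → ∑ n f ≈ ∑ n g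
  ∑-cong zero    f≈g = f≈g 0 z≤n
  ∑-cong (suc n) f≈g = +-cong (∑-cong n λ i i≤n → f≈g i (ℕP.m≤n⇒m≤1+n i≤n)) (f≈g (suc n) ℕP.≤-refl)

  ∑-zero : ∀ n {f : ℕ → Carrier} → (∀ i → i ≤ n → f i ≈ 0#) → ∑ n f ≈ 0#
  ∑-zero zero    f≈0 = f≈0 0 z≤n
  ∑-zero (suc n) f≈0 =
    trans (+-cong (∑-zero n λ i i≤n → f≈0 i (ℕP.m≤n⇒m≤1+n i≤n)) (f≈0 (suc n) ℕP.≤-refl)) (+-identityˡ 0#)

  ∑-single : ∀ n k {f : ℕ → Carrier} → k ≤ n → (∀ i → i ≤ n → i ≢ k → f i ≈ 0#) → ∑ n f ≈ f k
  ∑-single zero    zero    _   _   = refl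
  ∑-single (suc n) k   {f} k≤1+n f≈0 with k ℕ.≟ suc n
  ... | yes ≡.refl = trans (+-congʳ (∑-zero n λ i i≤n → f≈0 i (ℕP.m≤n⇒m≤1+n i≤n) λ { ≡.refl → ℕP.1+n≰n i≤n }))
                         (+-identityˡ _)
  ... | no k≢1+n = trans (+-cong (∑-single n k (ℕP.≤-pred (ℕP.≤∧≢⇒< k≤1+n k≢1+n)) λ i i≤n → f≈0 i (ℕP.m≤n⇒m≤1+n i≤n))
                                 (f≈0 (suc n) ℕP.≤-refl λ { ≡.refl → k≢1+n ≡.refl }))
                         (+-identityʳ _)

  ∑-extend : ∀ {m} n {f : ℕ → Carrier} → m ≤ n → (∀ i → m < i → i ≤ n → f i ≈ 0#) → ∑ n f ≈ ∑ m f
  ∑-extend n m≤n f≈0 with ℕP.m≤n⇒m<n∨m≡n m≤n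
  ... | inj₂ ≡.refl = refl
  ∑-extend (suc n) _ f≈0 | inj₁ (s≤s m≤n) =
    trans (+-cong (∑-extend n m≤n λ i m<i i≤n → f≈0 i m<i (ℕP.m≤n⇒m≤1+n i≤n)) (f≈0 (suc n) (s≤s m≤n) ℕP.≤-refl))
          (+-identityʳ _)

  ∑-+ : ∀ n (f g : ℕ → Carrier) → ∑ n (λ i → f i + g i) ≈ ∑ n f + ∑ n g
  ∑-+ zero    f g = refl
  ∑-+ (suc n) f g = trans (+-congʳ (∑-+ n f g)) (interchange _ _ _ _)

  ∑-*ˡ : ∀ n x (f : ℕ → Carrier) → x * ∑ n f ≈ ∑ n (λ i → x * f i)
  ∑-*ˡ zero    x f = refl
  ∑-*ˡ (suc n) x f = trans (distribˡ x (∑ n f) (f (suc n))) (+-congʳ (∑-*ˡ n x f))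

  ∑-*ʳ : ∀ n x (f : ℕ → Carrier) → ∑ n f * x ≈ ∑ n (λ i → f i * x)
  ∑-*ʳ zero    x f = refl
  ∑-*ʳ (suc n) x f = trans (distribʳ x (∑ n f) (f (suc n))) (+-congʳ (∑-*ʳ n x f))

  ∑-suc : ∀ n (f : ℕ → Carrier) → ∑ (suc n) f ≈ f 0 + ∑ n (λ i → f (suc i))
  ∑-suc zero    f = refl
  ∑-suc (suc n) f = trans (+-congʳ (∑-suc n f)) (+-assoc _ _ _)

  ∑-reverse : ∀ n (f : ℕ → Carrier) → ∑ n f ≈ ∑ n (λ i → f (n ∸ i))
  ∑-reverse zero    f = refl
  ∑-reverse (suc n) f = begin
    ∑ n f + f (suc n)                   ≈⟨ +-comm _ _ ⟩
    f (suc n) + ∑ n f                   ≈⟨ +-congˡ (∑-reverse n f) ⟩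
    f (suc n) + ∑ n (λ i → f (n ∸ i))   ≈⟨ ∑-suc n (λ i → f (suc n ∸ i)) ⟨
    ∑ (suc n) (λ i → f (suc n ∸ i))     ∎

  ∑-triangle : ∀ n (h : ℕ → ℕ → Carrier) →
    ∑ n (λ i → ∑ i (λ j → h j i)) ≈ ∑ n (λ j → ∑ (n ∸ j) (λ k → h j (j ℕ.+ k)))
  ∑-triangle zero    h = refl
  ∑-triangle (suc n) h = begin
    ∑ n (λ i → ∑ i (λ j → h j i)) + (∑ n (λ j → h j (suc n)) + h (suc n) (suc n))
      ≈⟨ +-congʳ (∑-triangle n h) ⟩
    ∑ n (λ j → ∑ (n ∸ j) (λ k → h j (j ℕ.+ k))) + (∑ n (λ j → h j (suc n)) + h (suc n) (suc n))
      ≈⟨ +-assoc _ _ _ ⟨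
    (∑ n (λ j → ∑ (n ∸ j) (λ k → h j (j ℕ.+ k))) + ∑ n (λ j → h j (suc n))) + h (suc n) (suc n)
      ≈⟨ +-cong (∑-+ n _ _) (reflexive (≡.cong (h (suc n)) (ℕP.+-identityʳ (suc n)))) ⟨
    ∑ n (λ j → ∑ (n ∸ j) (λ k → h j (j ℕ.+ k)) + h j (suc n)) + h (suc n) (suc n ℕ.+ 0)
      ≈⟨ +-cong (∑-cong n extend) (reflexive (≡.cong (λ m → ∑ m (λ k → h (suc n) (suc n ℕ.+ k))) (ℕP.n∸n≡0 n))) ⟨
    ∑ n (λ j → ∑ (suc n ∸ j) (λ k → h j (j ℕ.+ k))) + ∑ (n ∸ n) (λ k → h (suc n) (suc n ℕ.+ k)) ∎
    where
    extend : ∀ j → j ≤ n → ∑ (suc n ∸ j) (λ k → h j (j ℕ.+ k)) ≈ ∑ (n ∸ j) (λ k → h j (j ℕ.+ k)) + h j (suc n)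
    extend j j≤n rewrite ℕP.+-∸-assoc 1 j≤n =
      +-congˡ (reflexive (≡.cong (h j) (≡.trans (ℕP.+-suc j (n ∸ j)) (≡.cong suc (ℕP.m+[n∸m]≡n j≤n)))))

  Series : Set c
  Series = ℕ → Carrier

  _≋_ : Series → Series → Set ℓ
  f ≋ g = ∀ n → f n ≈ g n

  _⋆_ : Series → Series → Series
  (f ⋆ g) n = ∑ n (λ i → f i * g (n ∸ i))

  δ : Series
  δ zero    = 1#
  δ (suc n) = 0#

  ⋆-cong : ∀ {f f′ g g′} → f ≋ f′ → g ≋ g′ → (f ⋆ g) ≋ (f′ ⋆ g′)
  ⋆-cong f≋f′ g≋g′ n = ∑-cong n λ i _ → *-cong (f≋f′ i) (g≋g′ (n ∸ i))

  ⋆-comm : ∀ f g → (f ⋆ g) ≋ (g ⋆ f)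
  ⋆-comm f g n = trans (∑-reverse n _) (∑-cong n λ i i≤n →
    trans (*-comm _ _) (*-congʳ (reflexive (≡.cong g (ℕP.m∸[m∸n]≡n i≤n)))))

  ⋆-assoc : ∀ f g h → ((f ⋆ g) ⋆ h) ≋ (f ⋆ (g ⋆ h))
  ⋆-assoc f g h n = begin
    ∑ n (λ i → ∑ i (λ j → f j * g (i ∸ j)) * h (n ∸ i))
      ≈⟨ ∑-cong n (λ i _ → ∑-*ʳ i _ _) ⟩
    ∑ n (λ i → ∑ i (λ j → f j * g (i ∸ j) * h (n ∸ i)))
      ≈⟨ ∑-triangle n (λ j i → f j * g (i ∸ j) * h (n ∸ i)) ⟩
    ∑ n (λ j → ∑ (n ∸ j) (λ k → f j * g ((j ℕ.+ k) ∸ j) * h (n ∸ (j ℕ.+ k))))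
      ≈⟨ ∑-cong n (λ j _ → ∑-cong (n ∸ j) λ k _ → trans (*-assoc _ _ _) (*-congˡ (*-cong
           (reflexive (≡.cong g (ℕP.m+n∸m≡n j k))) (reflexive (≡.cong h (≡.sym (ℕP.∸-+-assoc n j k))))))) ⟩
    ∑ n (λ j → ∑ (n ∸ j) (λ k → f j * (g k * h ((n ∸ j) ∸ k))))
      ≈⟨ ∑-cong n (λ j _ → ∑-*ˡ (n ∸ j) _ _) ⟨
    ∑ n (λ j → f j * ∑ (n ∸ j) (λ k → g k * h ((n ∸ j) ∸ k))) ∎

  ⋆-identityˡ : ∀ f → (δ ⋆ f) ≋ f
  ⋆-identityˡ f zero    = *-identityˡ (f 0)
  ⋆-identityˡ f (suc n) = begin
    ∑ (suc n) (λ i → δ i * f (suc n ∸ i))        ≈⟨ ∑-suc n _ ⟩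
    1# * f (suc n) + ∑ n (λ i → 0# * f (n ∸ i))  ≈⟨ +-cong (*-identityˡ _) (∑-zero n λ i _ → zeroˡ _) ⟩
    f (suc n) + 0#                               ≈⟨ +-identityʳ _ ⟩
    f (suc n)                                    ∎

  seriesRing : CommutativeRing c ℓ
  seriesRing = record
    { Carrier = Series
    ; _≈_ = _≋_
    ; _+_ = λ f g n → f n + g n
    ; _*_ = _⋆_
    ; -_ = λ f n → - f n
    ; 0# = λ _ → 0#
    ; 1# = δ
    ; isCommutativeRing = record
      { isRing = record
        { +-isAbelianGroup = record
          { isGroup = record
            { isMonoid = record
              { isSemigroup = record
                { isMagma = record
                  { isEquivalence = record
                    { refl = λ _ → refl ; sym = λ p n → sym (p n) ; trans = λ p q n → trans (p n) (q n) }
                  ; ∙-cong = λ p q n → +-cong (p n) (q n) }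
                ; assoc = λ f g h n → +-assoc (f n) (g n) (h n) }
              ; identity = (λ f n → +-identityˡ (f n)) , (λ f n → +-identityʳ (f n)) }
            ; inverse = (λ f n → -‿inverseˡ (f n)) , (λ f n → -‿inverseʳ (f n))
            ; ⁻¹-cong = λ p n → -‿cong (p n) }
          ; comm = λ f g n → +-comm (f n) (g n) }
        ; *-cong = ⋆-cong
        ; *-assoc = ⋆-assoc
        ; *-identity = ⋆-identityˡ , (λ f n → trans (⋆-comm f δ n) (⋆-identityˡ f n))
        ; distrib = (λ f g h n → trans (∑-cong n λ i _ → distribˡ _ _ _) (∑-+ n _ _))
                  , (λ f g h n → trans (∑-cong n λ i _ → distribʳ _ _ _) (∑-+ n _ _)) }
      ; *-comm = ⋆-comm }
    }

open ≡ using (_≡_; _≢_; refl; cong; cong₂)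

module ℕ+ = CommSemigroupProperties ℕP.+-commutativeSemigroup

-- ℤ[[q,z]] is ℤ[[z]][[q]]: the outer index of a PS is the exponent of q.
module ℤ∑ = Convolution ℤP.+-*-commutativeRing
module ℤ[[z]]∑ = Convolution ℤ∑.seriesRing
module ℤ[[z]][[q]] = CommutativeRing ℤ[[z]]∑.seriesRing

sumTo≡∑ : ∀ n f → sumTo n f ≡ ℤ∑.∑ n f
sumTo≡∑ zero    f = refl
sumTo≡∑ (suc n) f = cong (ℤ._+ f (suc n)) (sumTo≡∑ n f)

sumTo-cong : ∀ n {f g : ℕ → ℤ} → (∀ i → i ≤ n → f i ≡ g i) → sumTo n f ≡ sumTo n g
sumTo-cong n f≡g = ≡.trans (sumTo≡∑ n _) (≡.trans (ℤ∑.∑-cong n f≡g) (≡.sym (sumTo≡∑ n _)))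

sumTo-zero : ∀ n {f : ℕ → ℤ} → (∀ i → i ≤ n → f i ≡ + 0) → sumTo n f ≡ + 0
sumTo-zero n f≡0 = ≡.trans (sumTo≡∑ n _) (ℤ∑.∑-zero n f≡0)

sumTo-single : ∀ n k {f : ℕ → ℤ} → k ≤ n → (∀ i → i ≤ n → i ≢ k → f i ≡ + 0) → sumTo n f ≡ f k
sumTo-single n k k≤n f≡0 = ≡.trans (sumTo≡∑ n _) (ℤ∑.∑-single n k k≤n f≡0)

sumTo-extend : ∀ {m} n {f : ℕ → ℤ} → m ≤ n → (∀ i → m < i → i ≤ n → f i ≡ + 0) → sumTo n f ≡ sumTo m f
sumTo-extend {m} n m≤n f≡0 =
  ≡.trans (sumTo≡∑ n _) (≡.trans (ℤ∑.∑-extend n m≤n f≡0) (≡.sym (sumTo≡∑ m _)))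

infix 4 _≐_
_≐_ : PS → PS → Set
F ≐ G = ∀ a b → F a b ≡ G a b

⊛≐⋆ : ∀ F G → F ⊛ G ≐ ℤ[[z]]∑._⋆_ F G
⊛≐⋆ F G a b = ≡.sym (≡.trans (pointwise a _) (sumTo-cong a λ i _ → ≡.sym (sumTo≡∑ b _)))
  where
  pointwise : ∀ n H → ℤ[[z]]∑.∑ n H b ≡ sumTo n (λ i → H i b)
  pointwise zero    H = refl
  pointwise (suc n) H = cong (ℤ._+ H (suc n) b) (pointwise n H)

one≐δ : one ≐ ℤ[[z]]∑.δ
one≐δ zero    zero    = refl
one≐δ zero    (suc b) = refl
one≐δ (suc a) b       = refl

psRing : CommutativeRing _ _
psRing = record
  { Carrier = PS
  ; _≈_ = _≐_
  ; _+_ = _⊕_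
  ; _*_ = _⊛_
  ; -_ = ℤ[[z]][[q]].-_
  ; 0# = ℤ[[z]][[q]].0#
  ; 1# = one
  ; isCommutativeRing = record
    { isRing = record
      { +-isAbelianGroup = ℤ[[z]][[q]].+-isAbelianGroup
      ; *-cong = λ {F} {F′} {G} {G′} p q → via (⊛≐⋆ F G) (ℤ[[z]][[q]].*-cong p q) (⊛≐⋆ F′ G′)
      ; *-assoc = λ F G H → via (≐-trans (⊛≐⋆ (F ⊛ G) H) (ℤ[[z]][[q]].*-congʳ {H} (⊛≐⋆ F G)))
                                (ℤ[[z]][[q]].*-assoc F G H)
                                (≐-trans (⊛≐⋆ F (G ⊛ H)) (ℤ[[z]][[q]].*-congˡ {F} (⊛≐⋆ G H)))
      ; *-identity = (λ F → via (≐-trans (⊛≐⋆ one F) (ℤ[[z]][[q]].*-congʳ {F} one≐δ))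
                                (ℤ[[z]][[q]].*-identityˡ F) (λ _ _ → refl))
                   , (λ F → via (≐-trans (⊛≐⋆ F one) (ℤ[[z]][[q]].*-congˡ {F} one≐δ))
                                (ℤ[[z]][[q]].*-identityʳ F) (λ _ _ → refl))
      ; distrib = (λ F G H → via (⊛≐⋆ F (G ⊕ H)) (ℤ[[z]][[q]].distribˡ F G H)
                                 (ℤ[[z]][[q]].+-cong (⊛≐⋆ F G) (⊛≐⋆ F H)))
                , (λ F G H → via (⊛≐⋆ (G ⊕ H) F) (ℤ[[z]][[q]].distribʳ F G H)
                                 (ℤ[[z]][[q]].+-cong (⊛≐⋆ G F) (⊛≐⋆ H F)))
      }
    ; *-comm = λ F G → via (⊛≐⋆ F G) (ℤ[[z]][[q]].*-comm F G) (⊛≐⋆ G F)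
    }
  }
  where
  ≐-trans : ∀ {F G H} → F ≐ G → G ≐ H → F ≐ H
  ≐-trans p q a b = ≡.trans (p a b) (q a b)
  via : ∀ {F F′ G G′} → F ≐ F′ → F′ ≐ G′ → G ≐ G′ → F ≐ G
  via p q r a b = ≡.trans (p a b) (≡.trans (q a b) (≡.sym (r a b)))

module ℤ[[q,z]] where
  open CommutativeRing psRing public
  open import Algebra.Properties.Ring ring public using (x[y-z]≈xy-xz)

open ℤ[[q,z]] using ( setoid; +-cong; +-congˡ; -‿cong; *-cong; *-congˡ; *-congʳ; *-assoc; *-comm
                     ; *-identityˡ; *-identityʳ; distribʳ; x[y-z]≈xy-xz; *-commutativeMonoid)
  renaming (refl to ≐-refl; sym to ≐-sym; trans to ≐-trans)

⊛-cong-below : ∀ {F F′} G a b → (∀ i j → i ≤ a → j ≤ b → F i j ≡ F′ i j) → (F ⊛ G) a b ≡ (F′ ⊛ G) a b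
⊛-cong-below G a b F≡F′ = sumTo-cong a λ i i≤a → sumTo-cong b λ j j≤b → cong (ℤ._* _) (F≡F′ i j i≤a j≤b)

pow-vanishes : ∀ X → X 0 0 ≡ + 0 → ∀ k a b → a ℕ.+ b < k → pow X k a b ≡ + 0
pow-vanishes X X₀₀ (suc k) a b (s≤s a+b≤k) =
  sumTo-zero a λ i i≤a → sumTo-zero b λ j j≤b → term i j i≤a j≤b
  where
  term : ∀ i j → i ≤ a → j ≤ b → X i j ℤ.* pow X k (a ∸ i) (b ∸ j) ≡ + 0
  term zero    zero    _   _   = cong (ℤ._* pow X k a b) X₀₀
  term (suc i) j       i≤a _   = ≡.trans (cong (X (suc i) j ℤ.*_) (pow-vanishes X X₀₀ k _ _
    (ℕP.<-≤-trans (ℕP.+-mono-<-≤ (ℕP.∸-monoʳ-< ℕ.z<s i≤a) (ℕP.m∸n≤m b j)) a+b≤k))) (ℤP.*-zeroʳ (X (suc i) j))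
  term zero    (suc j) _   j≤b = ≡.trans (cong (X 0 (suc j) ℤ.*_) (pow-vanishes X X₀₀ k _ _
    (ℕP.<-≤-trans (ℕP.+-mono-≤-< (ℕP.≤-refl {a}) (ℕP.∸-monoʳ-< ℕ.z<s j≤b)) a+b≤k))) (ℤP.*-zeroʳ (X 0 (suc j)))

module _ (F : PS) (F₀₀ : F 0 0 ≡ + 1) where
  private
    X : PS
    X = one ⊖ F

    X₀₀ : X 0 0 ≡ + 0
    X₀₀ = cong (λ x → + 1 ℤ.- x) F₀₀

    geometric : ℕ → PS
    geometric K a b = sumTo K λ k → pow X k a b

    geometric-sum : ∀ K → geometric K ⊛ (one ⊖ X) ≐ one ⊖ pow X (suc K)
    geometric-sum zero    = ≐-trans (*-identityˡ (one ⊖ X))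
                                           (+-congˡ {one} (-‿cong (≐-sym (*-identityʳ X))))
    geometric-sum (suc K) = begin
      (geometric K ⊕ P) ⊛ (one ⊖ X)               ≈⟨ distribʳ (one ⊖ X) (geometric K) P ⟩
      geometric K ⊛ (one ⊖ X) ⊕ P ⊛ (one ⊖ X)     ≈⟨ +-cong (geometric-sum K) (x[y-z]≈xy-xz P one X) ⟩
      (one ⊖ P) ⊕ (P ⊛ one ⊖ P ⊛ X)               ≈⟨ +-congˡ {one ⊖ P} (+-cong (*-identityʳ P)
                                                       (-‿cong {P ⊛ X} (*-comm P X))) ⟩
      (one ⊖ P) ⊕ (P ⊖ X ⊛ P)                     ≈⟨ (λ a b → ℤP.+-minus-telescope (one a b) (P a b) ((X ⊛ P) a b)) ⟩
      one ⊖ X ⊛ P                                 ∎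
      where
      open import Relation.Binary.Reasoning.Setoid setoid
      P = pow X (suc K)

    inv≡geometric : ∀ K i j → i ℕ.+ j ≤ K → geometric K i j ≡ inv F i j
    inv≡geometric K i j i+j≤K = sumTo-extend K i+j≤K λ k i+j<k _ → pow-vanishes X X₀₀ k i j i+j<k

  inv-⊛ : inv F ⊛ F ≐ one
  inv-⊛ a b = begin
    (inv F ⊛ F) a b           ≡⟨ ⊛-cong-below F a b (λ i j i≤a j≤b → inv≡geometric K i j (ℕP.+-mono-≤ i≤a j≤b)) ⟨
    (geometric K ⊛ F) a b     ≡⟨ *-congˡ {geometric K} F≐1-X a b ⟩
    (geometric K ⊛ (one ⊖ X)) a b   ≡⟨ geometric-sum K a b ⟩
    one a b ℤ.- pow X (suc K) a b   ≡⟨ cong (λ x → one a b ℤ.- x) (pow-vanishes X X₀₀ (suc K) a b ℕP.≤-refl) ⟩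
    one a b ℤ.- + 0                 ≡⟨ ℤP.+-identityʳ (one a b) ⟩
    one a b                         ∎
    where
    open ≡.≡-Reasoning
    K = a ℕ.+ b
    F≐1-X : F ≐ one ⊖ X
    F≐1-X a b = lemma (one a b) (F a b)
      where
      lemma : ∀ u v → v ≡ u ℤ.- (u ℤ.- v)
      lemma = ℤ-Solver.solve-∀

  inv-quotient : ∀ {Y M} → Y ⊛ F ≐ M → M ⊛ inv F ≐ Y
  inv-quotient {Y} {M} Y⊛F≐M = begin
    M ⊛ inv F          ≈⟨ *-congʳ {inv F} Y⊛F≐M ⟨
    (Y ⊛ F) ⊛ inv F    ≈⟨ *-assoc Y F (inv F) ⟩
    Y ⊛ (F ⊛ inv F)    ≈⟨ *-congˡ {Y} (≐-trans (*-comm F (inv F)) inv-⊛) ⟩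
    Y ⊛ one            ≈⟨ *-identityʳ Y ⟩
    Y                  ∎
    where open import Relation.Binary.Reasoning.Setoid setoid

≡ᵇ-refl : ∀ n → (n ≡ᵇ n) ≡ true
≡ᵇ-refl n = dec-true (n ℕ.≟ n) refl

≡ᵇ-false : ∀ m n → m ≢ n → (m ≡ᵇ n) ≡ false
≡ᵇ-false m n = dec-false (m ℕ.≟ n)

+-≡ᵇ-cancelˡ : ∀ x m n → (x ℕ.+ m ≡ᵇ x ℕ.+ n) ≡ (m ≡ᵇ n)
+-≡ᵇ-cancelˡ zero    m n = refl
+-≡ᵇ-cancelˡ (suc x) m n = +-≡ᵇ-cancelˡ x m n

mono-on : ∀ x y → mono x y x y ≡ + 1
mono-on x y rewrite ≡ᵇ-refl x | ≡ᵇ-refl y = refl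

mono-off : ∀ x y i j → i ≢ x ⊎ j ≢ y → mono x y i j ≡ + 0
mono-off x y i j (inj₁ i≢x) rewrite ≡ᵇ-false i x i≢x = refl
mono-off x y i j (inj₂ j≢y) rewrite ≡ᵇ-false j y j≢y | BoolP.∧-zeroʳ (i ≡ᵇ x) = refl

mono-+ : ∀ x y x′ y′ a b → mono (x ℕ.+ x′) (y ℕ.+ y′) (x ℕ.+ a) (y ℕ.+ b) ≡ mono x′ y′ a b
mono-+ x y x′ y′ a b rewrite +-≡ᵇ-cancelˡ x a x′ | +-≡ᵇ-cancelˡ y b y′ = refl

private
  mono-off-* : ∀ x y i j h → i ≢ x ⊎ j ≢ y → mono x y i j ℤ.* h ≡ + 0
  mono-off-* x y i j h i≢x⊎j≢y = cong (ℤ._* h) (mono-off x y i j i≢x⊎j≢y)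

mono-⊛-shift : ∀ x y H a b → (mono x y ⊛ H) (x ℕ.+ a) (y ℕ.+ b) ≡ H a b
mono-⊛-shift x y H a b = begin
  sumTo (x ℕ.+ a) (λ i → sumTo (y ℕ.+ b) λ j → mono x y i j ℤ.* H (x ℕ.+ a ∸ i) (y ℕ.+ b ∸ j))
    ≡⟨ sumTo-single (x ℕ.+ a) x (ℕP.m≤m+n x a) (λ i _ i≢x → sumTo-zero (y ℕ.+ b) λ j _ → mono-off-* x y i j _ (inj₁ i≢x)) ⟩
  sumTo (y ℕ.+ b) (λ j → mono x y x j ℤ.* H (x ℕ.+ a ∸ x) (y ℕ.+ b ∸ j))
    ≡⟨ sumTo-single (y ℕ.+ b) y (ℕP.m≤m+n y b) (λ j _ j≢y → mono-off-* x y x j _ (inj₂ j≢y)) ⟩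
  mono x y x y ℤ.* H (x ℕ.+ a ∸ x) (y ℕ.+ b ∸ y)
    ≡⟨ cong (ℤ._* H (x ℕ.+ a ∸ x) (y ℕ.+ b ∸ y)) (mono-on x y) ⟩
  + 1 ℤ.* H (x ℕ.+ a ∸ x) (y ℕ.+ b ∸ y)
    ≡⟨ ℤP.*-identityˡ _ ⟩
  H (x ℕ.+ a ∸ x) (y ℕ.+ b ∸ y)
    ≡⟨ cong₂ H (ℕP.m+n∸m≡n x a) (ℕP.m+n∸m≡n y b) ⟩
  H a b ∎
  where open ≡.≡-Reasoning

mono-⊛-below : ∀ x y H a b → a < x ⊎ b < y → (mono x y ⊛ H) a b ≡ + 0
mono-⊛-below x y H a b below =
  sumTo-zero a λ i i≤a → sumTo-zero b λ j j≤b → mono-off-* x y i j _ (miss i≤a j≤b below)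
  where
  miss : ∀ {i j} → i ≤ a → j ≤ b → a < x ⊎ b < y → i ≢ x ⊎ j ≢ y
  miss i≤a _ (inj₁ a<x) = inj₁ λ { refl → ℕP.<⇒≱ a<x i≤a }
  miss _ j≤b (inj₂ b<y) = inj₂ λ { refl → ℕP.<⇒≱ b<y j≤b }

mono-⊛-mono : ∀ x y x′ y′ → mono x y ⊛ mono x′ y′ ≐ mono (x ℕ.+ x′) (y ℕ.+ y′)
mono-⊛-mono x y x′ y′ a b with x ℕ.≤? a | y ℕ.≤? b
... | yes x≤a | yes y≤b = begin
  (mono x y ⊛ mono x′ y′) a b                                    ≡⟨ cong₂ (mono x y ⊛ mono x′ y′) a≡ b≡ ⟩
  (mono x y ⊛ mono x′ y′) (x ℕ.+ (a ∸ x)) (y ℕ.+ (b ∸ y))        ≡⟨ mono-⊛-shift x y (mono x′ y′) (a ∸ x) (b ∸ y) ⟩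
  mono x′ y′ (a ∸ x) (b ∸ y)                                     ≡⟨ mono-+ x y x′ y′ (a ∸ x) (b ∸ y) ⟨
  mono (x ℕ.+ x′) (y ℕ.+ y′) (x ℕ.+ (a ∸ x)) (y ℕ.+ (b ∸ y))     ≡⟨ cong₂ (mono (x ℕ.+ x′) (y ℕ.+ y′)) a≡ b≡ ⟨
  mono (x ℕ.+ x′) (y ℕ.+ y′) a b                                 ∎
  where
  open ≡.≡-Reasoning
  a≡ = ≡.sym (ℕP.m+[n∸m]≡n x≤a)
  b≡ = ≡.sym (ℕP.m+[n∸m]≡n y≤b)
... | no x≰a | _ = ≡.trans (mono-⊛-below x y (mono x′ y′) a b (inj₁ (ℕP.≰⇒> x≰a)))
                           (≡.sym (mono-off _ _ a b (inj₁ λ { refl → x≰a (ℕP.m≤m+n x x′) })))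
... | yes _ | no y≰b = ≡.trans (mono-⊛-below x y (mono x′ y′) a b (inj₂ (ℕP.≰⇒> y≰b)))
                               (≡.sym (mono-off _ _ a b (inj₂ λ { refl → y≰b (ℕP.m≤m+n y y′) })))

count-++ : ∀ {A : Set} (p : A → Bool) xs ys → count p (xs ++ ys) ≡ count p xs ℕ.+ count p ys
count-++ p []       ys = refl
count-++ p (x ∷ xs) ys = ≡.trans (cong (ind ℕ.+_) (count-++ p xs ys)) (≡.sym (ℕP.+-assoc ind (count p xs) (count p ys)))
  where ind = if p x then 1 else 0

count-map : ∀ {A B : Set} (p : B → Bool) (f : A → B) xs → count p (map f xs) ≡ count (p ∘ f) xs
count-map p f []       = refl
count-map p f (x ∷ xs) = cong (_ ℕ.+_) (count-map p f xs)

count-cong : ∀ {A : Set} {p q : A → Bool} xs → (∀ x → p x ≡ q x) → count p xs ≡ count q xs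
count-cong []       p≗q = refl
count-cong (x ∷ xs) p≗q = cong₂ (λ b n → (if b then 1 else 0) ℕ.+ n) (p≗q x) (count-cong xs p≗q)

count-false : ∀ {A : Set} {p : A → Bool} xs → (∀ x → p x ≡ false) → count p xs ≡ 0
count-false []       p≗false = refl
count-false (x ∷ xs) p≗false rewrite p≗false x = count-false xs p≗false

raise : List ℕ → List ℕ
raise = map suc

raiseWith1 : List ℕ → List ℕ
raiseWith1 μ = raise μ ++ 1 ∷ []

-- A partition with parts ≤ c + 1 either avoids the part 1 or contains it; removing the 1 and
-- lowering the remaining parts by one is a bijection onto the partitions with parts ≤ c.
count-dparts-suc : ∀ c (p : List ℕ → Bool) →
  count p (dparts (suc c)) ≡ count (p ∘ raise) (dparts c) ℕ.+ count (p ∘ raiseWith1) (dparts c)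
count-dparts-suc zero    p = cong (ℕ._+ count p (map (1 ∷_) (dparts 0))) (≡.sym (ℕP.+-identityʳ (if p [] then 1 else 0)))
count-dparts-suc (suc c) p = begin
  count p (dparts (suc c) ++ map c+2∷ (dparts (suc c)))
    ≡⟨ count-++ p (dparts (suc c)) _ ⟩
  count p (dparts (suc c)) ℕ.+ count p (map c+2∷ (dparts (suc c)))
    ≡⟨ cong₂ ℕ._+_ (count-dparts-suc c p)
                   (≡.trans (count-map p _ (dparts (suc c))) (count-dparts-suc c (p ∘ c+2∷))) ⟩
  (N (p ∘ raise) ℕ.+ N (p ∘ raiseWith1)) ℕ.+ (N (p ∘ c+2∷ ∘ raise) ℕ.+ N (p ∘ c+2∷ ∘ raiseWith1))
    ≡⟨ ℕ+.interchange (N (p ∘ raise)) _ _ _ ⟩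
  (N (p ∘ raise) ℕ.+ N (p ∘ c+2∷ ∘ raise)) ℕ.+ (N (p ∘ raiseWith1) ℕ.+ N (p ∘ c+2∷ ∘ raiseWith1))
    ≡⟨ cong₂ ℕ._+_ (split (p ∘ raise)) (split (p ∘ raiseWith1)) ⟨
  count (p ∘ raise) (dparts (suc c)) ℕ.+ count (p ∘ raiseWith1) (dparts (suc c)) ∎
  where
  open ≡.≡-Reasoning
  c+2∷ : List ℕ → List ℕ
  c+2∷ = suc (suc c) ∷_
  N : (List ℕ → Bool) → ℕ
  N q = count q (dparts c)
  split : ∀ q → count q (dparts (suc c)) ≡ N q ℕ.+ N (q ∘ (suc c ∷_))
  split q = ≡.trans (count-++ q (dparts c) _) (cong (N q ℕ.+_) (count-map q _ (dparts c)))

dparts-length≤ : ∀ c → All (λ λ′ → length λ′ ≤ c) (dparts c)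
dparts-length≤ zero    = z≤n ∷ []
dparts-length≤ (suc c) =
  AllP.++⁺ (All.map ℕP.m≤n⇒m≤1+n (dparts-length≤ c)) (AllP.map⁺ (All.map s≤s (dparts-length≤ c)))

⌈_/4⌉ : ℕ → ℕ
⌈ zero /4⌉                         = 0
⌈ suc zero /4⌉                     = 1
⌈ suc (suc zero) /4⌉               = 1
⌈ suc (suc (suc zero)) /4⌉         = 1
⌈ suc (suc (suc (suc n))) /4⌉      = suc ⌈ n /4⌉

-- Raising every part by one adds 1 to each of λ₁, λ₅, λ₉, …, i.e. ⌈ℓ/4⌉ in total.
every4th-raise : ∀ μ → every4th (raise μ) ≡ ⌈ length μ /4⌉ ℕ.+ every4th μ
every4th-raise []                    = refl
every4th-raise (x ∷ [])              = refl
every4th-raise (x ∷ _ ∷ [])          = refl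
every4th-raise (x ∷ _ ∷ _ ∷ [])      = refl
every4th-raise (x ∷ _ ∷ _ ∷ _ ∷ μ)   =
  cong suc (≡.trans (cong (x ℕ.+_) (every4th-raise μ)) (ℕ+.x∙yz≈y∙xz x ⌈ length μ /4⌉ (every4th μ)))

every4th-raiseWith1 : ∀ μ → every4th (raiseWith1 μ) ≡ ⌈ suc (length μ) /4⌉ ℕ.+ every4th μ
every4th-raiseWith1 []                    = refl
every4th-raiseWith1 (x ∷ [])              = refl
every4th-raiseWith1 (x ∷ _ ∷ [])          = refl
every4th-raiseWith1 (x ∷ _ ∷ _ ∷ [])      = cong suc (ℕP.+-identityʳ x)
every4th-raiseWith1 (x ∷ _ ∷ _ ∷ _ ∷ μ)   =
  cong suc (≡.trans (cong (x ℕ.+_) (every4th-raiseWith1 μ)) (ℕ+.x∙yz≈y∙xz x ⌈ suc (length μ) /4⌉ (every4th μ)))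

largest-raiseWith1 : ∀ μ → largest (raiseWith1 μ) ≡ suc (largest μ)
largest-raiseWith1 []      = refl
largest-raiseWith1 (x ∷ μ) = refl

length-raiseWith1 : ∀ μ → length (raiseWith1 μ) ≡ suc (length μ)
length-raiseWith1 μ = ≡.trans (ListP.length-++ (raise μ)) (≡.trans (ℕP.+-comm _ 1) (cong suc (ListP.length-map suc μ)))

hasShape : ℕ → ℕ → ℕ → List ℕ → Bool
hasShape m a b λ′ = (length λ′ ≡ᵇ m) ∧ (largest λ′ ≡ᵇ b) ∧ (every4th λ′ ≡ᵇ a)

dcount : ℕ → ℕ → ℕ → ℕ
dcount m a b = count (hasShape m a b) (dparts b)

hasShape-≡ : ∀ m a b λ′ {L X E} → length λ′ ≡ L → largest λ′ ≡ X → every4th λ′ ≡ E →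
             hasShape m a b λ′ ≡ (L ≡ᵇ m) ∧ (X ≡ᵇ b) ∧ (E ≡ᵇ a)
hasShape-≡ m a b λ′ refl refl refl = refl

≡ᵇ-∧-+-cancel : ∀ (f : ℕ → ℕ) L m B e a →
                (L ≡ᵇ m) ∧ B ∧ (f L ℕ.+ e ≡ᵇ f m ℕ.+ a) ≡ (L ≡ᵇ m) ∧ B ∧ (e ≡ᵇ a)
≡ᵇ-∧-+-cancel f L m B e a with L ℕ.≟ m
... | no L≢m rewrite ≡ᵇ-false L m L≢m = refl
... | yes refl rewrite ≡ᵇ-refl L = cong (B ∧_) (+-≡ᵇ-cancelˡ (f L) e a)

≡ᵇ-∧-+-short : ∀ (f : ℕ → ℕ) L m B e a → a < f m → (L ≡ᵇ m) ∧ B ∧ (f L ℕ.+ e ≡ᵇ a) ≡ false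
≡ᵇ-∧-+-short f L m B e a a<fm with L ℕ.≟ m
... | no L≢m rewrite ≡ᵇ-false L m L≢m = refl
... | yes refl rewrite ≡ᵇ-refl L
                     | ≡ᵇ-false (f L ℕ.+ e) a (λ fL+e≡a → ℕP.<⇒≱ a<fm (≡.subst (f L ≤_) fL+e≡a (ℕP.m≤m+n (f L) e)))
                     = BoolP.∧-zeroʳ B

module _ {λ′ : List ℕ} {L X E : ℕ} (length≡ : length λ′ ≡ suc L) (largest≡ : largest λ′ ≡ suc X)
         (every4th≡ : every4th λ′ ≡ ⌈ suc L /4⌉ ℕ.+ E) (m a b : ℕ) where
  private
    ⌈suc/4⌉ : ℕ → ℕ
    ⌈suc/4⌉ n = ⌈ suc n /4⌉

  hasShape-lower : hasShape (suc m) (⌈ suc m /4⌉ ℕ.+ a) (suc b) λ′ ≡ (L ≡ᵇ m) ∧ (X ≡ᵇ b) ∧ (E ≡ᵇ a)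
  hasShape-lower = ≡.trans (hasShape-≡ (suc m) (⌈ suc m /4⌉ ℕ.+ a) (suc b) λ′ length≡ largest≡ every4th≡)
                           (≡ᵇ-∧-+-cancel ⌈suc/4⌉ L m (X ≡ᵇ b) E a)

  hasShape-short : a < ⌈ suc m /4⌉ → hasShape (suc m) a (suc b) λ′ ≡ false
  hasShape-short a<c = ≡.trans (hasShape-≡ (suc m) a (suc b) λ′ length≡ largest≡ every4th≡)
                               (≡ᵇ-∧-+-short ⌈suc/4⌉ L m (X ≡ᵇ b) E a a<c)

module _ (m a b : ℕ) where
  private
    c = ⌈ suc m /4⌉

  dcount-suc : dcount (suc m) (c ℕ.+ a) (suc b) ≡ dcount (suc m) a b ℕ.+ dcount m a b
  dcount-suc = ≡.trans (count-dparts-suc b _) (cong₂ ℕ._+_ (count-cong (dparts b) raised) (count-cong (dparts b) λ μ →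
    hasShape-lower {raiseWith1 μ} (length-raiseWith1 μ) (largest-raiseWith1 μ) (every4th-raiseWith1 μ) m a b))
    where
    raised : ∀ μ → hasShape (suc m) (c ℕ.+ a) (suc b) (raise μ) ≡ hasShape (suc m) a b μ
    raised []      = refl
    raised (x ∷ μ) = hasShape-lower {raise (x ∷ μ)} (ListP.length-map suc (x ∷ μ)) refl (every4th-raise (x ∷ μ)) m a b

  dcount-below : a < c → dcount (suc m) a (suc b) ≡ 0
  dcount-below a<c = ≡.trans (count-dparts-suc b _) (cong₂ ℕ._+_ (count-false (dparts b) raised) (count-false (dparts b) λ μ →
    hasShape-short {raiseWith1 μ} (length-raiseWith1 μ) (largest-raiseWith1 μ) (every4th-raiseWith1 μ) m a b a<c))
    where
    raised : ∀ μ → hasShape (suc m) a (suc b) (raise μ) ≡ false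
    raised []      = refl
    raised (x ∷ μ) = hasShape-short {raise (x ∷ μ)} (ListP.length-map suc (x ∷ μ)) refl (every4th-raise (x ∷ μ)) m a b a<c

dcount-zero : ∀ a b → dcount 0 a (suc b) ≡ 0
dcount-zero a b = ≡.trans (count-dparts-suc b _) (cong₂ ℕ._+_ (count-false (dparts b) nonempty) (count-false (dparts b) λ μ →
  hasShape-≡ 0 a (suc b) (raiseWith1 μ) (length-raiseWith1 μ) refl refl))
  where
  nonempty : ∀ μ → hasShape 0 a (suc b) (raise μ) ≡ false
  nonempty []      = refl
  nonempty (x ∷ μ) = refl

-- The hypotheses say H = q^x z^y (H + G) coefficientwise.
shift-recurrence : ∀ x y {H G : PS} →
  (∀ a b → H (x ℕ.+ a) (y ℕ.+ b) ≡ H a b ℤ.+ G a b) →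
  (∀ a b → a < x ⊎ b < y → H a b ≡ + 0) →
  H ⊛ (one ⊖ mono x y) ≐ mono x y ⊛ G
shift-recurrence x y {H} {G} step low = begin
  H ⊛ (one ⊖ M)        ≈⟨ x[y-z]≈xy-xz H one M ⟩
  H ⊛ one ⊖ H ⊛ M      ≈⟨ +-cong (*-identityʳ H) (-‿cong (*-comm H M)) ⟩
  H ⊖ M ⊛ H            ≈⟨ coefficients ⟩
  M ⊛ G                ∎
  where
  open import Relation.Binary.Reasoning.Setoid setoid
  M = mono x y
  shifted : ∀ a b → (H ⊖ M ⊛ H) (x ℕ.+ a) (y ℕ.+ b) ≡ (M ⊛ G) (x ℕ.+ a) (y ℕ.+ b)
  shifted a b = ≡.trans (cong₂ ℤ._-_ (step a b) (mono-⊛-shift x y H a b))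
                (≡.trans (cancel (H a b) (G a b)) (≡.sym (mono-⊛-shift x y G a b)))
    where
    cancel : ∀ u v → u ℤ.+ v ℤ.- u ≡ v
    cancel = ℤ-Solver.solve-∀
  vanishing : ∀ a b → a < x ⊎ b < y → (H ⊖ M ⊛ H) a b ≡ (M ⊛ G) a b
  vanishing a b below = ≡.trans (cong₂ ℤ._-_ (low a b below) (mono-⊛-below x y H a b below))
                                (≡.sym (mono-⊛-below x y G a b below))
  coefficients : H ⊖ M ⊛ H ≐ M ⊛ G
  coefficients a b with x ℕ.≤? a | y ℕ.≤? b
  ... | yes x≤a | yes y≤b = ≡.subst₂ (λ a b → (H ⊖ M ⊛ H) a b ≡ (M ⊛ G) a b)
                              (ℕP.m+[n∸m]≡n x≤a) (ℕP.m+[n∸m]≡n y≤b) (shifted (a ∸ x) (b ∸ y))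
  ... | no x≰a | _     = vanishing a b (inj₁ (ℕP.≰⇒> x≰a))
  ... | yes _ | no y≰b = vanishing a b (inj₂ (ℕP.≰⇒> y≰b))

D : ℕ → PS
D m a b = + dcount m a b

D-zero : D 0 ≐ one
D-zero zero    zero    = refl
D-zero (suc a) zero    = refl
D-zero a       (suc b) = ≡.trans (cong +_ (dcount-zero a b)) (≡.sym (mono-off 0 0 a (suc b) (inj₂ λ ())))

D-recurrence : ∀ m → D (suc m) ⊛ (one ⊖ mono ⌈ suc m /4⌉ 1) ≐ mono ⌈ suc m /4⌉ 1 ⊛ D m
D-recurrence m = shift-recurrence ⌈ suc m /4⌉ 1 {D (suc m)} {D m}
  (λ a b → ≡.trans (cong +_ (dcount-suc m a b)) (ℤP.pos-+ (dcount (suc m) a b) (dcount m a b))) low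
  where
  low : ∀ a b → a < ⌈ suc m /4⌉ ⊎ b < 1 → D (suc m) a b ≡ + 0
  low a zero    _              = refl
  low a (suc b) (inj₁ a<c)     = cong +_ (dcount-below m a b a<c)
  low a (suc b) (inj₂ (s≤s ()))

E : ℕ → PS
E zero    = one
E (suc m) = E m ⊛ (one ⊖ mono ⌈ suc m /4⌉ 1)

E-constant : ∀ m → E m 0 0 ≡ + 1
E-constant zero    = refl
E-constant (suc m) rewrite E-constant m | BoolP.∧-zeroʳ (0 ≡ᵇ ⌈ suc m /4⌉) = refl

Σ⌈_/4⌉ : ℕ → ℕ
Σ⌈ zero /4⌉  = 0
Σ⌈ suc m /4⌉ = ⌈ suc m /4⌉ ℕ.+ Σ⌈ m /4⌉

D-⊛-E : ∀ m → D m ⊛ E m ≐ mono Σ⌈ m /4⌉ m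
D-⊛-E zero    = ≐-trans (*-identityʳ (D 0)) D-zero
D-⊛-E (suc m) = begin
  D (suc m) ⊛ (E m ⊛ f)       ≈⟨ *-congˡ {D (suc m)} (*-comm (E m) f) ⟩
  D (suc m) ⊛ (f ⊛ E m)       ≈⟨ *-assoc (D (suc m)) f (E m) ⟨
  (D (suc m) ⊛ f) ⊛ E m       ≈⟨ *-congʳ {E m} (D-recurrence m) ⟩
  (mono c 1 ⊛ D m) ⊛ E m      ≈⟨ *-assoc (mono c 1) (D m) (E m) ⟩
  mono c 1 ⊛ (D m ⊛ E m)      ≈⟨ *-congˡ {mono c 1} (D-⊛-E m) ⟩
  mono c 1 ⊛ mono Σ⌈ m /4⌉ m  ≈⟨ mono-⊛-mono c 1 Σ⌈ m /4⌉ m ⟩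
  mono Σ⌈ suc m /4⌉ (suc m)   ∎
  where
  open import Relation.Binary.Reasoning.Setoid setoid
  c = ⌈ suc m /4⌉
  f = one ⊖ mono c 1

D-pair-⊛-E : ∀ m → (D (suc m) ⊕ D m) ⊛ E (suc m) ≐ mono Σ⌈ m /4⌉ m
D-pair-⊛-E m = begin
  (D (suc m) ⊕ D m) ⊛ E (suc m)              ≈⟨ distribʳ (E (suc m)) (D (suc m)) (D m) ⟩
  D (suc m) ⊛ E (suc m) ⊕ D m ⊛ (E m ⊛ f)    ≈⟨ +-cong (D-⊛-E (suc m)) (≐-sym (*-assoc (D m) (E m) f)) ⟩
  M′ ⊕ (D m ⊛ E m) ⊛ f                       ≈⟨ +-congˡ {M′} (*-congʳ {f} (D-⊛-E m)) ⟩
  M′ ⊕ M ⊛ (one ⊖ mono c 1)                  ≈⟨ +-congˡ {M′} (x[y-z]≈xy-xz M one (mono c 1)) ⟩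
  M′ ⊕ (M ⊛ one ⊖ M ⊛ mono c 1)              ≈⟨ +-congˡ {M′} (+-cong (*-identityʳ M)
                                                  (-‿cong (≐-trans (mono-⊛-mono Σ⌈ m /4⌉ m c 1) same-monomial))) ⟩
  M′ ⊕ (M ⊖ M′)                              ≈⟨ (λ a b → cancel (M′ a b) (M a b)) ⟩
  M                                          ∎
  where
  open import Relation.Binary.Reasoning.Setoid setoid
  c = ⌈ suc m /4⌉
  f = one ⊖ mono c 1
  M = mono Σ⌈ m /4⌉ m
  M′ = mono Σ⌈ suc m /4⌉ (suc m)
  same-monomial : mono (Σ⌈ m /4⌉ ℕ.+ c) (m ℕ.+ 1) ≐ M′
  same-monomial a b = cong₂ (λ x y → mono x y a b) (ℕP.+-comm Σ⌈ m /4⌉ c) (ℕP.+-comm m 1)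
  cancel : ∀ u v → u ℤ.+ (v ℤ.- u) ≡ v
  cancel = ℤ-Solver.solve-∀

D-pair : ∀ m {F} → E (suc m) ≐ F → mono Σ⌈ m /4⌉ m ⊛ inv F ≐ D (suc m) ⊕ D m
D-pair m {F} E≐F = inv-quotient F (≡.trans (≡.sym (E≐F 0 0)) (E-constant (suc m)))
  (≐-trans (*-congˡ {D (suc m) ⊕ D m} (≐-sym E≐F)) (D-pair-⊛-E m))

⌈1+r+k*4/4⌉ : ∀ (r : Fin 4) k → ⌈ suc (Fin.toℕ r) ℕ.+ k ℕ.* 4 /4⌉ ≡ suc k
⌈1+r+k*4/4⌉ 0F zero    = refl
⌈1+r+k*4/4⌉ 1F zero    = refl
⌈1+r+k*4/4⌉ 2F zero    = refl
⌈1+r+k*4/4⌉ 3F zero    = refl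
⌈1+r+k*4/4⌉ 0F (suc k) = cong suc (⌈1+r+k*4/4⌉ 0F k)
⌈1+r+k*4/4⌉ 1F (suc k) = cong suc (⌈1+r+k*4/4⌉ 1F k)
⌈1+r+k*4/4⌉ 2F (suc k) = cong suc (⌈1+r+k*4/4⌉ 2F k)
⌈1+r+k*4/4⌉ 3F (suc k) = cong suc (⌈1+r+k*4/4⌉ 3F k)

module ⊛-Solver = CommMonoidSolver *-commutativeMonoid

factor-cong : ∀ {m n} → m ≡ n → one ⊖ mono m 1 ≐ one ⊖ mono n 1
factor-cong refl = ≐-refl

module _ (k : ℕ) where
  private
    factor : ∀ r → one ⊖ mono ⌈ suc (Fin.toℕ r) ℕ.+ k ℕ.* 4 /4⌉ 1 ≐ one ⊖ mono (suc k) 1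
    factor r = factor-cong (⌈1+r+k*4/4⌉ r k)
    open ⊛-Solver using (id; var) renaming (_⊕_ to _∙_)
    p f p⁴ : ⊛-Solver.Expr 2
    p = var 0F
    f = var 1F
    p⁴ = p ∙ (p ∙ (p ∙ (p ∙ id)))

  E-quadruple-suc : E (k ℕ.* 4) ≐ pow (poch k) 4 → E (suc k ℕ.* 4) ≐ pow (poch (suc k)) 4
  E-quadruple-suc E≐ = ≐-trans
    (*-cong (*-cong (*-cong (*-cong E≐ (factor 0F)) (factor 1F)) (factor 2F)) (factor 3F))
    (⊛-Solver.prove 2 ((((p⁴ ∙ f) ∙ f) ∙ f) ∙ f) ((p ∙ f) ∙ ((p ∙ f) ∙ ((p ∙ f) ∙ ((p ∙ f) ∙ id))))
                      (poch k ∷ one ⊖ mono (suc k) 1 ∷ []))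

  E-double : E (k ℕ.* 4) ≐ pow (poch k) 4 → E (2 ℕ.+ k ℕ.* 4) ≐ pow (poch (suc k)) 2 ⊛ pow (poch k) 2
  E-double E≐ = ≐-trans
    (*-cong (*-cong E≐ (factor 0F)) (factor 1F))
    (⊛-Solver.prove 2 ((p⁴ ∙ f) ∙ f) (((p ∙ f) ∙ ((p ∙ f) ∙ id)) ∙ (p ∙ (p ∙ id)))
                      (poch k ∷ one ⊖ mono (suc k) 1 ∷ []))

E-quadruple : ∀ k → E (k ℕ.* 4) ≐ pow (poch k) 4
E-quadruple zero    = ⊛-Solver.prove 0 id (id ∙ (id ∙ (id ∙ (id ∙ id)))) []
  where open ⊛-Solver using (id) renaming (_⊕_ to _∙_)
E-quadruple (suc k) = E-quadruple-suc k (E-quadruple k)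

C₂-suc : ∀ n → suc n C 2 ≡ n ℕ.+ n C 2
C₂-suc n = ≡.trans (≡.sym (nCk+nC[k+1]≡[n+1]C[k+1] n 1)) (cong (ℕ._+ n C 2) (nC1≡n n))

Σ⌈3+k*4/4⌉ : ∀ k → Σ⌈ 3 ℕ.+ k ℕ.* 4 /4⌉ ≡ (2 ℕ.* suc k ℕ.+ 1) C 2
Σ⌈3+k*4/4⌉ zero    = refl
Σ⌈3+k*4/4⌉ (suc k) = begin
  Σ⌈ 3 ℕ.+ suc k ℕ.* 4 /4⌉
    ≡⟨ cong₂ ℕ._+_ (cong suc (⌈1+r+k*4/4⌉ 2F k)) (cong₂ ℕ._+_ (cong suc (⌈1+r+k*4/4⌉ 1F k))
         (cong₂ ℕ._+_ (cong suc (⌈1+r+k*4/4⌉ 0F k)) (cong₂ ℕ._+_ (⌈1+r+k*4/4⌉ 3F k) (Σ⌈3+k*4/4⌉ k)))) ⟩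
  suc (suc k) ℕ.+ (suc (suc k) ℕ.+ (suc (suc k) ℕ.+ (suc k ℕ.+ n C 2)))
    ≡⟨ regroup k (n C 2) ⟩
  suc n ℕ.+ (n ℕ.+ n C 2)
    ≡⟨ cong (suc n ℕ.+_) (C₂-suc n) ⟨
  suc n ℕ.+ suc n C 2
    ≡⟨ C₂-suc (suc n) ⟨
  suc (suc n) C 2
    ≡⟨ cong (_C 2) (index k) ⟩
  (2 ℕ.* suc (suc k) ℕ.+ 1) C 2 ∎
  where
  open ≡.≡-Reasoning
  n = 2 ℕ.* suc k ℕ.+ 1
  regroup : ∀ k X → suc (suc k) ℕ.+ (suc (suc k) ℕ.+ (suc (suc k) ℕ.+ (suc k ℕ.+ X)))
                  ≡ suc (2 ℕ.* suc k ℕ.+ 1) ℕ.+ ((2 ℕ.* suc k ℕ.+ 1) ℕ.+ X)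
  regroup = ℕ-Solver.solve-∀
  index : ∀ k → suc (suc (2 ℕ.* suc k ℕ.+ 1)) ≡ 2 ℕ.* suc (suc k) ℕ.+ 1
  index = ℕ-Solver.solve-∀

Σ⌈1+k*4/4⌉ : ∀ k → Σ⌈ 1 ℕ.+ k ℕ.* 4 /4⌉ ≡ (2 ℕ.* suc k) C 2
Σ⌈1+k*4/4⌉ zero    = refl
Σ⌈1+k*4/4⌉ (suc k) = begin
  Σ⌈ 1 ℕ.+ suc k ℕ.* 4 /4⌉
    ≡⟨ cong₂ ℕ._+_ (cong suc (⌈1+r+k*4/4⌉ 0F k)) (cong₂ ℕ._+_ (⌈1+r+k*4/4⌉ 3F k)
         (cong₂ ℕ._+_ (⌈1+r+k*4/4⌉ 2F k) (cong₂ ℕ._+_ (⌈1+r+k*4/4⌉ 1F k) (Σ⌈1+k*4/4⌉ k)))) ⟩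
  suc (suc k) ℕ.+ (suc k ℕ.+ (suc k ℕ.+ (suc k ℕ.+ n C 2)))
    ≡⟨ regroup k (n C 2) ⟩
  suc n ℕ.+ (n ℕ.+ n C 2)
    ≡⟨ cong (suc n ℕ.+_) (C₂-suc n) ⟨
  suc n ℕ.+ suc n C 2
    ≡⟨ C₂-suc (suc n) ⟨
  suc (suc n) C 2
    ≡⟨ cong (_C 2) (index k) ⟩
  (2 ℕ.* suc (suc k)) C 2 ∎
  where
  open ≡.≡-Reasoning
  n = 2 ℕ.* suc k
  regroup : ∀ k X → suc (suc k) ℕ.+ (suc k ℕ.+ (suc k ℕ.+ (suc k ℕ.+ X)))
                  ≡ suc (2 ℕ.* suc k) ℕ.+ ((2 ℕ.* suc k) ℕ.+ X)
  regroup = ℕ-Solver.solve-∀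
  index : ∀ k → suc (suc (2 ℕ.* suc k)) ≡ 2 ℕ.* suc (suc k)
  index = ℕ-Solver.solve-∀

term₁-pair : ∀ k → term₁ (suc k) ≐ D (4 ℕ.+ k ℕ.* 4) ⊕ D (3 ℕ.+ k ℕ.* 4)
term₁-pair k = ≐-trans
  (λ a b → cong₂ (λ x y → (mono x y ⊛ inv (pow (poch (suc k)) 4)) a b)
                 (≡.sym (Σ⌈3+k*4/4⌉ k)) (cong (_∸ 1) (ℕP.*-comm 4 (suc k))))
  (D-pair (3 ℕ.+ k ℕ.* 4) (E-quadruple (suc k)))

term₂-pair : ∀ k → term₂ (suc k) ≐ D (2 ℕ.+ k ℕ.* 4) ⊕ D (1 ℕ.+ k ℕ.* 4)
term₂-pair k = ≐-trans
  (λ a b → cong₂ (λ x y → (mono x y ⊛ inv (pow (poch (suc k)) 2 ⊛ pow (poch k) 2)) a b)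
                 (≡.sym (Σ⌈1+k*4/4⌉ k)) (cong (_∸ 3) (ℕP.*-comm 4 (suc k))))
  (D-pair (1 ℕ.+ k ℕ.* 4) (E-double k (E-quadruple k)))

⟦_⟧ : Bool → ℤ
⟦ b ⟧ = + (if b then 1 else 0)

⟦∧⟧ : ∀ b c → ⟦ b ⟧ ℤ.* ⟦ c ⟧ ≡ ⟦ b ∧ c ⟧
⟦∧⟧ true  c = ℤP.*-identityˡ ⟦ c ⟧
⟦∧⟧ false c = refl

sumTo-+ : ∀ n (f g : ℕ → ℤ) → sumTo n (λ i → f i ℤ.+ g i) ≡ sumTo n f ℤ.+ sumTo n g
sumTo-+ n f g = ≡.trans (sumTo≡∑ n _) (≡.trans (ℤ∑.∑-+ n f g) (≡.sym (cong₂ ℤ._+_ (sumTo≡∑ n f) (sumTo≡∑ n g))))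

count-by-value : ∀ {A : Set} (f : A → ℕ) M (P : ℕ → Bool) (Q : A → Bool) xs → All (λ x → f x ≤ M) xs →
  + count (λ x → P (f x) ∧ Q x) xs ≡ sumTo M (λ m → ⟦ P m ⟧ ℤ.* + count (λ x → (f x ≡ᵇ m) ∧ Q x) xs)
count-by-value f M P Q []       []                 = ≡.sym (sumTo-zero M λ m _ → ℤP.*-zeroʳ ⟦ P m ⟧)
count-by-value f M P Q (x ∷ xs) (fx≤M ∷ bounded) = begin
  + (count (λ y → P (f y) ∧ Q y) (x ∷ xs))
    ≡⟨ ℤP.pos-+ _ (count (λ y → P (f y) ∧ Q y) xs) ⟩
  ⟦ P (f x) ∧ Q x ⟧ ℤ.+ + count (λ y → P (f y) ∧ Q y) xs
    ≡⟨ cong₂ ℤ._+_ (≡.sym single) (count-by-value f M P Q xs bounded) ⟩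
  sumTo M (λ m → ⟦ P m ⟧ ℤ.* ⟦ (f x ≡ᵇ m) ∧ Q x ⟧) ℤ.+ sumTo M (λ m → ⟦ P m ⟧ ℤ.* + N m xs)
    ≡⟨ sumTo-+ M _ _ ⟨
  sumTo M (λ m → ⟦ P m ⟧ ℤ.* ⟦ (f x ≡ᵇ m) ∧ Q x ⟧ ℤ.+ ⟦ P m ⟧ ℤ.* + N m xs)
    ≡⟨ sumTo-cong M (λ m _ → ≡.trans (≡.sym (ℤP.*-distribˡ-+ ⟦ P m ⟧ _ _))
                                     (cong (⟦ P m ⟧ ℤ.*_) (≡.sym (ℤP.pos-+ _ (N m xs))))) ⟩
  sumTo M (λ m → ⟦ P m ⟧ ℤ.* + N m (x ∷ xs)) ∎
  where
  open ≡.≡-Reasoning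
  N : ℕ → List _ → ℕ
  N m = count (λ y → (f y ≡ᵇ m) ∧ Q y)
  single : sumTo M (λ m → ⟦ P m ⟧ ℤ.* ⟦ (f x ≡ᵇ m) ∧ Q x ⟧) ≡ ⟦ P (f x) ∧ Q x ⟧
  single = ≡.trans
    (sumTo-single M (f x) fx≤M λ m _ m≢fx →
      ≡.trans (cong (λ b → ⟦ P m ⟧ ℤ.* ⟦ b ∧ Q x ⟧) (≡ᵇ-false (f x) m (m≢fx ∘ ≡.sym))) (ℤP.*-zeroʳ ⟦ P m ⟧))
    (≡.trans (cong (λ b → ⟦ P (f x) ⟧ ℤ.* ⟦ b ∧ Q x ⟧) (≡ᵇ-refl (f x))) (⟦∧⟧ (P (f x)) (Q x)))

is0or3 is1or2 : ℕ → Bool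
is0or3 r = (r ≡ᵇ 0) ∨ (r ≡ᵇ 3)
is1or2 r = (r ≡ᵇ 1) ∨ (r ≡ᵇ 2)

module _ (G : ℕ → PS) (a b : ℕ) where
  private
    block : ∀ (R : ℕ → Bool) j N → ⟦ R ((j ℕ.+ N ℕ.* 4) % 4) ⟧ ℤ.* G (j ℕ.+ N ℕ.* 4) a b
                                 ≡ ⟦ R (j % 4) ⟧ ℤ.* G (j ℕ.+ N ℕ.* 4) a b
    block R j N = cong (λ r → ⟦ R r ⟧ ℤ.* G (j ℕ.+ N ℕ.* 4) a b) ([m+kn]%n≡m%n j N 4)

  sumTo-is0or3 : ∀ N → sumTo (N ℕ.* 4) (λ m → ⟦ is0or3 (m % 4) ⟧ ℤ.* G m a b)
                     ≡ G 0 a b ℤ.+ sumSeries1 N (λ n → G (n ℕ.* 4) ⊕ G (n ℕ.* 4 ∸ 1)) a b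
  sumTo-is0or3 zero    = ≡.trans (ℤP.*-identityˡ (G 0 a b)) (≡.sym (ℤP.+-identityʳ (G 0 a b)))
  sumTo-is0or3 (suc N) =
    ≡.trans (cong₂ ℤ._+_ (cong₂ ℤ._+_ (cong₂ ℤ._+_ (cong₂ ℤ._+_ (sumTo-is0or3 N)
                                        (block is0or3 1 N)) (block is0or3 2 N)) (block is0or3 3 N)) (block is0or3 4 N))
            (regroup (G 0 a b) (sumSeries1 N (λ n → G (n ℕ.* 4) ⊕ G (n ℕ.* 4 ∸ 1)) a b) (g 1) (g 2) (g 3) (g 4))
    where
    g : ℕ → ℤ
    g j = G (j ℕ.+ N ℕ.* 4) a b
    regroup : ∀ u s x y v w → u ℤ.+ s ℤ.+ + 0 ℤ.* x ℤ.+ + 0 ℤ.* y ℤ.+ + 1 ℤ.* v ℤ.+ + 1 ℤ.* w ≡ u ℤ.+ (s ℤ.+ (w ℤ.+ v))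
    regroup = ℤ-Solver.solve-∀

  sumTo-is1or2 : ∀ N → sumTo (N ℕ.* 4) (λ m → ⟦ is1or2 (m % 4) ⟧ ℤ.* G m a b)
                     ≡ sumSeries1 N (λ n → G (n ℕ.* 4 ∸ 2) ⊕ G (n ℕ.* 4 ∸ 3)) a b
  sumTo-is1or2 zero    = refl
  sumTo-is1or2 (suc N) =
    ≡.trans (cong₂ ℤ._+_ (cong₂ ℤ._+_ (cong₂ ℤ._+_ (cong₂ ℤ._+_ (sumTo-is1or2 N)
                                        (block is1or2 1 N)) (block is1or2 2 N)) (block is1or2 3 N)) (block is1or2 4 N))
            (regroup (sumSeries1 N (λ n → G (n ℕ.* 4 ∸ 2) ⊕ G (n ℕ.* 4 ∸ 3)) a b) (g 1) (g 2) (g 3) (g 4))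
    where
    g : ℕ → ℤ
    g j = G (j ℕ.+ N ℕ.* 4) a b
    regroup : ∀ s v w x y → s ℤ.+ + 1 ℤ.* v ℤ.+ + 1 ℤ.* w ℤ.+ + 0 ℤ.* x ℤ.+ + 0 ℤ.* y ≡ s ℤ.+ (w ℤ.+ v)
    regroup = ℤ-Solver.solve-∀

sumSeries1-cong : ∀ N {F G : ℕ → PS} → (∀ k → F (suc k) ≐ G (suc k)) → sumSeries1 N F ≐ sumSeries1 N G
sumSeries1-cong zero    F≐G a b = refl
sumSeries1-cong (suc N) F≐G a b = cong₂ ℤ._+_ (sumSeries1-cong N F≐G a b) (F≐G N a b)

genD-by-length : ∀ (P : ℕ → Bool) N a b → b ≤ N →
  genD (P ∘ (_% 4) ∘ length) a b ≡ sumTo (N ℕ.* 4) (λ m → ⟦ P (m % 4) ⟧ ℤ.* D m a b)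
genD-by-length P N a b b≤N =
  count-by-value length (N ℕ.* 4) (P ∘ (_% 4)) (λ λ′ → (largest λ′ ≡ᵇ b) ∧ (every4th λ′ ≡ᵇ a)) (dparts b)
    (All.map (λ ℓ≤b → ℕP.≤-trans ℓ≤b (ℕP.≤-trans b≤N (ℕP.m≤m*n N 4))) (dparts-length≤ b))

RHS₁-converges : ConvergesTo RHS₁ LHS₁
RHS₁-converges a b = b , λ N b≤N → ≡.sym (begin
  LHS₁ a b                                                                ≡⟨ genD-by-length is0or3 N a b b≤N ⟩
  sumTo (N ℕ.* 4) (λ m → ⟦ is0or3 (m % 4) ⟧ ℤ.* D m a b)                  ≡⟨ sumTo-is0or3 D a b N ⟩
  D 0 a b ℤ.+ sumSeries1 N (λ n → D (n ℕ.* 4) ⊕ D (n ℕ.* 4 ∸ 1)) a b     ≡⟨ cong₂ ℤ._+_ (D-zero a b)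
                                                                               (≡.sym (sumSeries1-cong N term₁-pair a b)) ⟩
  RHS₁ N a b                                                              ∎)
  where open ≡.≡-Reasoning

RHS₂-converges : ConvergesTo RHS₂ LHS₂
RHS₂-converges a b = b , λ N b≤N → ≡.sym (begin
  LHS₂ a b                                                                ≡⟨ genD-by-length is1or2 N a b b≤N ⟩
  sumTo (N ℕ.* 4) (λ m → ⟦ is1or2 (m % 4) ⟧ ℤ.* D m a b)                  ≡⟨ sumTo-is1or2 D a b N ⟩
  sumSeries1 N (λ n → D (n ℕ.* 4 ∸ 2) ⊕ D (n ℕ.* 4 ∸ 3)) a b              ≡⟨ sumSeries1-cong N term₂-pair a b ⟨
  RHS₂ N a b                                                              ∎)
  where open ≡.≡-Reasoning

theorem3 : ConvergesTo RHS₁ LHS₁ × ConvergesTo RHS₂ LHS₂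
theorem3 = RHS₁-converges , RHS₂-converges
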